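{- Let $G=(V,E)$ be a graph with $V=[n]$, and regard $E$ as a family of $2$-element subsets of $[n]$. Then $\beta_0(E)=\lceil\log_2\chi(G)\rceil$, where $\chi(G)$ is the chromatic number of $G$. Consequently $\beta_0(n,2)=\lceil\log_2 n\rceil$.
   Context: For a positive integer $n$, $[n]=\{1,\dots,n\}$ and $\binom{[n]}{k}$ is the family of all $k$-element subsets of $[n]$. For a set $D$ of integers and families $\mathcal{F},\mathcal{F}'$ of subsets of $[n]$, $\mathcal{F}'$ is called $D$-secting for $\mathcal{F}$ if for every $A\in\mathcal{F}$ there exists $A'\in\mathcal{F}'$ with $|A\cap A'|-|A\cap([n]\setminus A')|\in D$. $\beta_D(\mathcal{F})$ is the minimum cardinality of a $D$-secting family for $\mathcal{F}$; $\beta_0$ denotes $\beta_D$ with $D=\{0\}$. $\beta_0(n,k)$ is the maximum of $\beta_0(\mathcal{F})$ over all families $\mathcal{F}\subseteq\binom{[n]}{k}$. -}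

module Defs where

open import Data.Nat using (ℕ; _≤_)
open import Data.Integer as ℤ using (ℤ; +_)
open import Data.Fin using (Fin)
open import Data.Fin.Subset using (Subset; _∩_; ∁; ∣_∣; _∈_)
open import Data.List using (List; length)
open import Data.List.Relation.Unary.All using (All)
open import Data.List.Relation.Unary.Any using (Any)
import Data.List.Membership.Propositional as LM
open import Data.Product using (Σ; _×_)
open import Relation.Binary.PropositionalEquality using (_≡_; _≢_)

-- A family of subsets of [n] (n is represented by Fin n); its cardinality
-- is the length of the list.  Repetitions never help in minimisation.
Family : ℕ → Set
Family n = List (Subset n)

disc : ∀ {n} → Subset n → Subset n → ℤ
disc A A' = (+ ∣ A ∩ A' ∣) ℤ.- (+ ∣ A ∩ ∁ A' ∣)

Secting : ∀ {n} → (ℤ → Set) → Family n → Family n → Set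
Secting D F F' = All (λ A → Any (λ A' → D (disc A A')) F') F

D0 : ℤ → Set
D0 z = z ≡ + 0

IsBetaD : ∀ {n} → (ℤ → Set) → Family n → ℕ → Set
IsBetaD D F m =
  Σ (Family _) (λ F' → Secting D F F' × length F' ≡ m)
  × (∀ (F' : Family _) → Secting D F F' → m ≤ length F')

IsBeta0 : ∀ {n} → Family n → ℕ → Set
IsBeta0 = IsBetaD D0

IsKUniform : ∀ {n} → ℕ → Family n → Set
IsKUniform k F = All (λ A → ∣ A ∣ ≡ k) F

IsBeta0nk : (n k : ℕ) → ℕ → Set
IsBeta0nk n k m =
  Σ (Family n) (λ F → IsKUniform k F × IsBeta0 F m)
  × (∀ (F : Family n) → IsKUniform k F → ∀ m' → IsBeta0 F m' → m' ≤ m)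

ProperColouring : ∀ {n} → Family n → (k : ℕ) → (Fin n → Fin k) → Set
ProperColouring {n} E k c =
  ∀ (e : Subset n) → e LM.∈ E → ∀ (i j : Fin n) → i ∈ e → j ∈ e → i ≢ j → c i ≢ c j

Colourable : ∀ {n} → Family n → ℕ → Set
Colourable {n} E k = Σ (Fin n → Fin k) (ProperColouring E k)

IsChromaticNumber : ∀ {n} → Family n → ℕ → Set
IsChromaticNumber E m = Colourable E m × (∀ k → Colourable E k → m ≤ k)

-- For an edge e = {i, j}, disc e A = 0 says exactly that A contains one endpoint of e and not
-- the other.  Hence a family F' of m sets is 0-secting for E iff the membership vectors
-- i ↦ (i ∈ A)_{A ∈ F'} ∈ {0,1}^m form a proper colouring of the graph; conversely a proper
-- colouring with at most 2^m colours, written in binary, yields m such sets, one per bit.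
-- So β₀(E) is the least m with χ ≤ 2^m, namely ⌈log₂ χ⌉.  Every graph on [n] is n-colourable
-- and the complete graph needs n colours, which gives β₀(n,2) = ⌈log₂ n⌉.

module Submission where

open import Defs
open import Data.Nat using (ℕ; _≤_)
open import Data.Nat.Logarithm using (⌈log₂_⌉)
open import Data.Product using (_×_)

open import Data.Bool using (Bool; true; false) renaming (_≟_ to _≟-Bool_)
open import Data.Empty using (⊥)
open import Data.Fin as Fin using (Fin; zero; suc; combine; remQuot; inject≤)
import Data.Fin.Properties as FinP
open import Data.Fin.Subset
  using (Subset; inside; outside; _∩_; _∪_; ∁; ∣_∣; _∈_; ⁅_⁆; Nonempty)
import Data.Fin.Subset.Properties as SubsetP
import Data.Integer as ℤ
import Data.Integer.Properties as ℤP
open import Data.List as List using (List; []; _∷_; length; filter; _++_)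
open import Data.List.Relation.Unary.All as All using (All)
open import Data.List.Relation.Unary.All.Properties using (all-filter)
open import Data.List.Relation.Unary.Any as Any using (Any; here; there)
import Data.List.Membership.Propositional as List
open import Data.List.Membership.Propositional.Properties
  using (∈-++⁺ˡ; ∈-++⁺ʳ; ∈-map⁺; ∈-filter⁺)
open import Data.Nat as ℕ using (zero; suc; _+_; _*_; _^_; _<_; z≤n; s≤s)
import Data.Nat.Properties as ℕP
open import Data.Nat.Logarithm using (⌈log₂⌉-mono-≤; ⌈log₂2^n⌉≡n)
open import Data.Nat.Logarithm.Core using (⌈log2⌉)
open import Data.Product using (Σ; ∃₂; _,_; proj₁; proj₂)
import Data.Product as Product
open import Data.Sum using (inj₁; inj₂)
open import Data.Vec as Vec using (Vec; []; _∷_; lookup; head; tail; tabulate)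
import Data.Vec.Properties as VecP
open import Function using (_∘_)
open import Function.Bundles using (Inverse)
open import Induction.WellFounded using (Acc; acc)
open import Relation.Nullary using (yes; no; contradiction)
open import Relation.Binary.PropositionalEquality

private
  variable
    n m k : ℕ

∣p∩q∣+∣p∩∁q∣≡∣p∣ : ∀ (p q : Subset n) → ∣ p ∩ q ∣ + ∣ p ∩ ∁ q ∣ ≡ ∣ p ∣
∣p∩q∣+∣p∩∁q∣≡∣p∣ []            []            = refl
∣p∩q∣+∣p∩∁q∣≡∣p∣ (inside ∷ p)  (inside ∷ q)  = cong suc (∣p∩q∣+∣p∩∁q∣≡∣p∣ p q)
∣p∩q∣+∣p∩∁q∣≡∣p∣ (inside ∷ p)  (outside ∷ q) =
  trans (ℕP.+-suc ∣ p ∩ q ∣ _) (cong suc (∣p∩q∣+∣p∩∁q∣≡∣p∣ p q))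
∣p∩q∣+∣p∩∁q∣≡∣p∣ (outside ∷ p) (inside ∷ q)  = ∣p∩q∣+∣p∩∁q∣≡∣p∣ p q
∣p∩q∣+∣p∩∁q∣≡∣p∣ (outside ∷ p) (outside ∷ q) = ∣p∩q∣+∣p∩∁q∣≡∣p∣ p q

x∈p⇒1≤∣p∣ : ∀ {x : Fin n} {p} → x ∈ p → 1 ≤ ∣ p ∣
x∈p⇒1≤∣p∣ x∈p = ℕP.≤-<-trans z≤n (SubsetP.x∈p⇒∣p-x∣<∣p∣ x∈p)

x,y∈p⇒2≤∣p∣ : ∀ {x y : Fin n} {p} → x ∈ p → y ∈ p → x ≢ y → 2 ≤ ∣ p ∣
x,y∈p⇒2≤∣p∣ x∈p y∈p x≢y =
  ℕP.≤-trans (s≤s (x∈p⇒1≤∣p∣ (SubsetP.x∈p∧x≢y⇒x∈p-y y∈p (x≢y ∘ sym))))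
             (SubsetP.x∈p⇒∣p-x∣<∣p∣ x∈p)

1≤∣p∣⇒Nonempty : ∀ (p : Subset n) → 1 ≤ ∣ p ∣ → Nonempty p
1≤∣p∣⇒Nonempty (inside ∷ p)  _ = zero , Vec.here
1≤∣p∣⇒Nonempty (outside ∷ p) h = Product.map suc Vec.there (1≤∣p∣⇒Nonempty p h)

2≤∣p∣⇒distinct : ∀ (p : Subset n) → 2 ≤ ∣ p ∣ → ∃₂ λ x y → x ∈ p × y ∈ p × x ≢ y
2≤∣p∣⇒distinct (inside ∷ p) (s≤s h) =
  let y , y∈p = 1≤∣p∣⇒Nonempty p h in zero , suc y , Vec.here , Vec.there y∈p , λ ()
2≤∣p∣⇒distinct (outside ∷ p) h =
  let x , y , x∈p , y∈p , x≢y = 2≤∣p∣⇒distinct p h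
  in suc x , suc y , Vec.there x∈p , Vec.there y∈p , x≢y ∘ FinP.suc-injective

x∈p∩q-by-lookup : ∀ {x : Fin n} {p q} → x ∈ p → lookup q x ≡ true → x ∈ p ∩ q
x∈p∩q-by-lookup x∈p qx = SubsetP.x∈p∩q⁺ (x∈p , VecP.lookup⇒[]= _ _ qx)

x∈p∩∁q-by-lookup : ∀ {x : Fin n} {p q} → x ∈ p → lookup q x ≡ false → x ∈ p ∩ ∁ q
x∈p∩∁q-by-lookup x∈p qx = SubsetP.x∈p∩q⁺
  (x∈p , SubsetP.x∉p⇒x∈∁p (λ x∈q → contradiction (trans (sym (VecP.[]=⇒lookup x∈q)) qx) λ ()))

m+n≡2⇒m≡n : ∀ {m n} → 1 ≤ m → 1 ≤ n → m + n ≡ 2 → m ≡ n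
m+n≡2⇒m≡n {1}           {1}           _ _ _  = refl
m+n≡2⇒m≡n {1}           {suc (suc _)} _ _ ()
m+n≡2⇒m≡n {suc (suc m)} {suc _}       _ _ eq =
  contradiction (ℕP.suc-injective (ℕP.suc-injective eq)) (ℕP.m+1+n≢0 m)

m+m≡2⇒m≡1 : ∀ {m} → m + m ≡ 2 → m ≡ 1
m+m≡2⇒m≡1 {1}           _  = refl
m+m≡2⇒m≡1 {suc (suc m)} eq =
  contradiction (ℕP.suc-injective (ℕP.suc-injective eq)) (ℕP.m+1+n≢0 m)

record Endpoints (e : Subset n) (i j : Fin n) : Set where
  field
    size : ∣ e ∣ ≡ 2
    i∈e  : i ∈ e
    j∈e  : j ∈ e
    i≢j  : i ≢ j

endpoints : ∀ {e : Subset n} → ∣ e ∣ ≡ 2 → ∃₂ (Endpoints e)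
endpoints {e = e} ∣e∣≡2 =
  let i , j , i∈e , j∈e , i≢j = 2≤∣p∣⇒distinct e (ℕP.≤-reflexive (sym ∣e∣≡2))
  in i , j , record { size = ∣e∣≡2 ; i∈e = i∈e ; j∈e = j∈e ; i≢j = i≢j }

Separates : Subset n → Fin n → Fin n → Set
Separates A i j = lookup A i ≢ lookup A j

module _ {e : Subset n} {i j : Fin n} (ij : Endpoints e i j) (A : Subset n) where
  open Endpoints ij

  private
    halves : ∣ e ∩ A ∣ + ∣ e ∩ ∁ A ∣ ≡ 2
    halves = trans (∣p∩q∣+∣p∩∁q∣≡∣p∣ e A) size

    2≰1 : 2 ≤ 1 → ⊥
    2≰1 (s≤s ())

    balanced⇒disc≡0 : 1 ≤ ∣ e ∩ A ∣ → 1 ≤ ∣ e ∩ ∁ A ∣ → D0 (disc e A)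
    balanced⇒disc≡0 inA outA = ℤP.i≡j⇒i-j≡0 (cong ℤ.+_ (m+n≡2⇒m≡n inA outA halves))

    disc≡0⇒halves≡1 : D0 (disc e A) → ∣ e ∩ A ∣ ≡ 1 × ∣ e ∩ ∁ A ∣ ≡ 1
    disc≡0⇒halves≡1 d = ∣e∩A∣≡1 , trans (sym ∣e∩A∣≡∣e∩∁A∣) ∣e∩A∣≡1
      where
      ∣e∩A∣≡∣e∩∁A∣ : ∣ e ∩ A ∣ ≡ ∣ e ∩ ∁ A ∣
      ∣e∩A∣≡∣e∩∁A∣ = ℤP.+-injective (ℤP.i-j≡0⇒i≡j _ _ d)
      ∣e∩A∣≡1 : ∣ e ∩ A ∣ ≡ 1
      ∣e∩A∣≡1 = m+m≡2⇒m≡1 (subst (λ b → ∣ e ∩ A ∣ + b ≡ 2) (sym ∣e∩A∣≡∣e∩∁A∣) halves)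

  separates⇒disc≡0 : Separates A i j → D0 (disc e A)
  separates⇒disc≡0 sep with lookup A i in Ai | lookup A j in Aj
  ... | true  | true  = contradiction refl sep
  ... | false | false = contradiction refl sep
  ... | true  | false = balanced⇒disc≡0 (x∈p⇒1≤∣p∣ (x∈p∩q-by-lookup i∈e Ai))
                                        (x∈p⇒1≤∣p∣ (x∈p∩∁q-by-lookup j∈e Aj))
  ... | false | true  = balanced⇒disc≡0 (x∈p⇒1≤∣p∣ (x∈p∩q-by-lookup j∈e Aj))
                                        (x∈p⇒1≤∣p∣ (x∈p∩∁q-by-lookup i∈e Ai))

  -- If both endpoints lie on one side of A, that side of e has two elements.
  disc≡0⇒separates : D0 (disc e A) → Separates A i j
  disc≡0⇒separates d Ai≡Aj with lookup A i in Ai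
  ... | true  = 2≰1 (subst (2 ≤_) (proj₁ (disc≡0⇒halves≡1 d))
                       (x,y∈p⇒2≤∣p∣ (x∈p∩q-by-lookup i∈e Ai)
                                    (x∈p∩q-by-lookup j∈e (sym Ai≡Aj)) i≢j))
  ... | false = 2≰1 (subst (2 ≤_) (proj₂ (disc≡0⇒halves≡1 d))
                       (x,y∈p⇒2≤∣p∣ (x∈p∩∁q-by-lookup i∈e Ai)
                                    (x∈p∩∁q-by-lookup j∈e (sym Ai≡Aj)) i≢j))

private module Bit = Inverse FinP.2↔Bool

toFin : Vec Bool m → Fin (2 ^ m)
toFin []       = zero
toFin (b ∷ bs) = combine (Bit.from b) (toFin bs)

fromFin : ∀ m → Fin (2 ^ m) → Vec Bool m
fromFin zero    _ = []
fromFin (suc m) i = Bit.to (proj₁ (remQuot {2} (2 ^ m) i))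
                  ∷ fromFin m (proj₂ (remQuot {2} (2 ^ m) i))

fromFin-toFin : ∀ (bs : Vec Bool m) → fromFin m (toFin bs) ≡ bs
fromFin-toFin []       = refl
fromFin-toFin {suc m} (b ∷ bs) = begin
  fromFin (suc m) (combine (Bit.from b) (toFin bs))
    ≡⟨ cong (λ (c , i) → Bit.to c ∷ fromFin m i) (FinP.remQuot-combine (Bit.from b) (toFin bs)) ⟩
  Bit.to (Bit.from b) ∷ fromFin m (toFin bs)
    ≡⟨ cong₂ _∷_ (Bit.strictlyInverseˡ b) (fromFin-toFin bs) ⟩
  b ∷ bs
    ∎
  where open ≡-Reasoning

toFin-fromFin : ∀ m (i : Fin (2 ^ m)) → toFin (fromFin m i) ≡ i
toFin-fromFin zero    zero = refl
toFin-fromFin (suc m) i = begin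
  combine (Bit.from (Bit.to b)) (toFin (fromFin m j))
    ≡⟨ cong₂ combine (Bit.strictlyInverseʳ b) (toFin-fromFin m j) ⟩
  combine b j
    ≡⟨ FinP.combine-remQuot {2} (2 ^ m) i ⟩
  i
    ∎
  where
  open ≡-Reasoning
  b = proj₁ (remQuot {2} (2 ^ m) i)
  j = proj₂ (remQuot {2} (2 ^ m) i)

toFin-injective : ∀ {bs cs : Vec Bool m} → toFin bs ≡ toFin cs → bs ≡ cs
toFin-injective {bs = bs} {cs} eq =
  trans (sym (fromFin-toFin bs)) (trans (cong (fromFin _) eq) (fromFin-toFin cs))

fromFin-injective : ∀ m {i j : Fin (2 ^ m)} → fromFin m i ≡ fromFin m j → i ≡ j
fromFin-injective m {i} {j} eq =
  trans (sym (toFin-fromFin m i)) (trans (cong toFin eq) (toFin-fromFin m j))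

membership : (F : Family n) → Fin n → Vec Bool (length F)
membership []      i = []
membership (A ∷ F) i = lookup A i ∷ membership F i

Separated : Family n → Fin n → Fin n → Set
Separated F i j = Any (λ A → Separates A i j) F

separated⇒membership≢ : ∀ (F : Family n) {i j} →
                        Separated F i j → membership F i ≢ membership F j
separated⇒membership≢ (A ∷ F) (here  Ai≢Aj) = Ai≢Aj ∘ VecP.∷-injectiveˡ
separated⇒membership≢ (A ∷ F) (there sep)   = separated⇒membership≢ F sep ∘ VecP.∷-injectiveʳ

head-tail-injective : ∀ {A : Set} (u v : Vec A (suc m)) →
                      head u ≡ head v → tail u ≡ tail v → u ≡ v
head-tail-injective (x ∷ u) (y ∷ v) = cong₂ _∷_

bitPlanes : ∀ m → (Fin n → Vec Bool m) → Family n
bitPlanes zero    code = []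
bitPlanes (suc m) code = tabulate (head ∘ code) ∷ bitPlanes m (tail ∘ code)

length-bitPlanes : ∀ m (code : Fin n → Vec Bool m) → length (bitPlanes m code) ≡ m
length-bitPlanes zero    code = refl
length-bitPlanes (suc m) code = cong suc (length-bitPlanes m (tail ∘ code))

bitPlanes-separated : ∀ m (code : Fin n → Vec Bool m) {i j} →
                      code i ≢ code j → Separated (bitPlanes m code) i j
bitPlanes-separated zero    code {i} {j} ci≢cj with code i | code j
... | [] | [] = contradiction refl ci≢cj
bitPlanes-separated (suc m) code {i} {j} ci≢cj with head (code i) ≟-Bool head (code j)
... | no  hi≢hj = here λ eq → hi≢hj (begin
  head (code i)                    ≡⟨ VecP.lookup∘tabulate (head ∘ code) i ⟨
  lookup (tabulate (head ∘ code)) i ≡⟨ eq ⟩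
  lookup (tabulate (head ∘ code)) j ≡⟨ VecP.lookup∘tabulate (head ∘ code) j ⟩
  head (code j)                    ∎)
  where open ≡-Reasoning
... | yes hi≡hj = there (bitPlanes-separated m (tail ∘ code)
                           λ ti≡tj → ci≢cj (head-tail-injective (code i) (code j) hi≡hj ti≡tj))

secting⇒colourable : ∀ {E : Family n} → IsKUniform 2 E → ∀ {F} → Secting D0 E F →
                     Colourable E (2 ^ length F)
secting⇒colourable {E = E} uniform {F} secting = toFin ∘ membership F , proper
  where
  proper : ProperColouring E (2 ^ length F) (toFin ∘ membership F)
  proper e e∈E i j i∈e j∈e i≢j =
    separated⇒membership≢ F (Any.map (disc≡0⇒separates ij _) (All.lookup secting e∈E))
    ∘ toFin-injective
    where
    ij : Endpoints e i j
    ij = record { size = All.lookup uniform e∈E ; i∈e = i∈e ; j∈e = j∈e ; i≢j = i≢j }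

colourable⇒secting : ∀ {n k m} {E : Family n} → IsKUniform 2 E → Colourable E k → k ≤ 2 ^ m →
                     Σ (Family n) λ F → Secting D0 E F × length F ≡ m
colourable⇒secting {n} {k} {m} {E} uniform (c , proper) k≤2^m =
  bitPlanes m code , All.tabulate secting , length-bitPlanes m code
  where
  code : Fin n → Vec Bool m
  code = fromFin m ∘ (λ i → inject≤ i k≤2^m) ∘ c

  secting : ∀ {e} → e List.∈ E → Any (λ A → D0 (disc e A)) (bitPlanes m code)
  secting {e} e∈E =
    let i , j , ij = endpoints (All.lookup uniform e∈E)
        open Endpoints ij
        ci≢cj = proper e e∈E i j i∈e j∈e i≢j
          ∘ FinP.inject≤-injective k≤2^m k≤2^m _ _ ∘ fromFin-injective m
    in Any.map (separates⇒disc≡0 ij _) (bitPlanes-separated m code ci≢cj)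

n≤2^⌈log₂n⌉ : ∀ n → n ≤ 2 ^ ⌈log₂ n ⌉
n≤2^⌈log₂n⌉ n = go n _
  where
  -- Recursion along the accessibility proof that defines ⌈log₂ n⌉.
  go : ∀ n (rec : Acc _<_ n) → n ≤ 2 ^ ⌈log2⌉ n rec
  go zero          _        = z≤n
  go (suc zero)    _        = s≤s z≤n
  go (suc (suc n)) (acc rs) = begin
    2 + n                ≤⟨ s≤s (s≤s n≤2⌈n/2⌉) ⟩
    2 + (h + h)          ≡⟨ cong suc (ℕP.+-suc h h) ⟨
    suc h + suc h        ≡⟨ cong (suc h +_) (ℕP.+-identityʳ (suc h)) ⟨
    2 * suc h            ≤⟨ ℕP.*-monoʳ-≤ 2 (go (suc h) (rs (ℕP.⌈n/2⌉<n n))) ⟩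
    2 * 2 ^ ⌈log2⌉ (suc h) (rs (ℕP.⌈n/2⌉<n n)) ∎
    where
    open ℕP.≤-Reasoning
    h = ℕ.⌈ n /2⌉
    n≤2⌈n/2⌉ : n ≤ h + h
    n≤2⌈n/2⌉ = subst (_≤ h + h) (ℕP.⌊n/2⌋+⌈n/2⌉≡n n) (ℕP.+-monoˡ-≤ h (ℕP.⌊n/2⌋≤⌈n/2⌉ n))

≤2^⇒⌈log₂⌉≤ : k ≤ 2 ^ m → ⌈log₂ k ⌉ ≤ m
≤2^⇒⌈log₂⌉≤ {m = m} k≤2^m = subst (_ ≤_) (⌈log₂2^n⌉≡n m) (⌈log₂⌉-mono-≤ k≤2^m)

allSubsets : ∀ n → List (Subset n)
allSubsets zero    = [] ∷ []
allSubsets (suc n) =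
  List.map (inside ∷_) (allSubsets n) ++ List.map (outside ∷_) (allSubsets n)

∈-allSubsets : ∀ (p : Subset n) → p List.∈ allSubsets n
∈-allSubsets []            = here refl
∈-allSubsets (inside ∷ p)  = ∈-++⁺ˡ (∈-map⁺ (inside ∷_) (∈-allSubsets p))
∈-allSubsets {suc n} (outside ∷ p) =
  ∈-++⁺ʳ (List.map (inside ∷_) (allSubsets n)) (∈-map⁺ (outside ∷_) (∈-allSubsets p))

completeGraph : ∀ n → Family n
completeGraph n = filter (λ e → ∣ e ∣ ℕ.≟ 2) (allSubsets n)

completeGraph-uniform : ∀ n → IsKUniform 2 (completeGraph n)
completeGraph-uniform n = all-filter (λ e → ∣ e ∣ ℕ.≟ 2) (allSubsets n)

∣⁅x⁆∪⁅y⁆∣≡2 : ∀ {x y : Fin n} → x ≢ y → ∣ ⁅ x ⁆ ∪ ⁅ y ⁆ ∣ ≡ 2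
∣⁅x⁆∪⁅y⁆∣≡2 {x = zero}  {zero}  x≢y = contradiction refl x≢y
∣⁅x⁆∪⁅y⁆∣≡2 {x = zero}  {suc y} _   =
  cong suc (trans (cong ∣_∣ (SubsetP.∪-identityˡ ⁅ y ⁆)) (SubsetP.∣⁅x⁆∣≡1 y))
∣⁅x⁆∪⁅y⁆∣≡2 {x = suc x} {zero}  _   =
  cong suc (trans (cong ∣_∣ (SubsetP.∪-identityʳ ⁅ x ⁆)) (SubsetP.∣⁅x⁆∣≡1 x))
∣⁅x⁆∪⁅y⁆∣≡2 {x = suc x} {suc y} x≢y = ∣⁅x⁆∪⁅y⁆∣≡2 (x≢y ∘ cong suc)

⁅x⁆∪⁅y⁆∈completeGraph : ∀ {x y : Fin n} → x ≢ y → ⁅ x ⁆ ∪ ⁅ y ⁆ List.∈ completeGraph n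
⁅x⁆∪⁅y⁆∈completeGraph x≢y = ∈-filter⁺ (λ e → ∣ e ∣ ℕ.≟ 2) (∈-allSubsets _) (∣⁅x⁆∪⁅y⁆∣≡2 x≢y)

identity-colouring : ∀ (E : Family n) → Colourable E n
identity-colouring E = (λ i → i) , λ _ _ _ _ _ _ i≢j → i≢j

completeGraph-colourable⇒n≤k : Colourable (completeGraph n) k → n ≤ k
completeGraph-colourable⇒n≤k (c , proper) = FinP.injective⇒≤ c-injective
  where
  c-injective : ∀ {x y} → c x ≡ c y → x ≡ y
  c-injective {x} {y} cx≡cy with x Fin.≟ y
  ... | yes x≡y = x≡y
  ... | no  x≢y = contradiction cx≡cy
    (proper _ (⁅x⁆∪⁅y⁆∈completeGraph x≢y) x y
            (SubsetP.x∈p∪q⁺ (inj₁ (SubsetP.x∈⁅x⁆ x)))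
            (SubsetP.x∈p∪q⁺ (inj₂ (SubsetP.x∈⁅x⁆ y))) x≢y)

completeGraph-chromatic : ∀ n → IsChromaticNumber (completeGraph n) n
completeGraph-chromatic n =
  identity-colouring (completeGraph n) , λ _ → completeGraph-colourable⇒n≤k

β₀≡⌈log₂χ⌉ : ∀ {E : Family n} {χ} →
             IsKUniform 2 E → IsChromaticNumber E χ → IsBeta0 E ⌈log₂ χ ⌉
β₀≡⌈log₂χ⌉ {χ = χ} uniform (colourable , minimal) =
  colourable⇒secting uniform colourable (n≤2^⌈log₂n⌉ χ) ,
  λ F secting → ≤2^⇒⌈log₂⌉≤ (minimal _ (secting⇒colourable uniform secting))

β₀≤⌈log₂n⌉ : ∀ {E : Family n} {β} → IsKUniform 2 E → IsBeta0 E β → β ≤ ⌈log₂ n ⌉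
β₀≤⌈log₂n⌉ {n} {E} uniform (_ , minimal) =
  let F , secting , length≡ = colourable⇒secting uniform (identity-colouring E) (n≤2^⌈log₂n⌉ n)
  in subst (_ ≤_) length≡ (minimal F secting)

corollary1 : (∀ (n : ℕ) → 1 ≤ n → ∀ (E : Family n) → IsKUniform 2 E →
    ∀ (χ : ℕ) → IsChromaticNumber E χ → IsBeta0 E ⌈log₂ χ ⌉)
    × (∀ (n : ℕ) → 1 ≤ n → IsBeta0nk n 2 ⌈log₂ n ⌉)
corollary1 =
  (λ n _ E uniform χ → β₀≡⌈log₂χ⌉ uniform) ,
  λ n _ →
    (completeGraph n , completeGraph-uniform n ,
     β₀≡⌈log₂χ⌉ (completeGraph-uniform n) (completeGraph-chromatic n)) ,
    λ F uniform β → β₀≤⌈log₂n⌉ uniform
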